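{- Let $d_k(n)$ be as in the context and let $E_n=\frac{\sum_k k\, d_k(n)}{\sum_k d_k(n)}$ be the expected number of pieces in a uniformly random division of a honeycomb strip of length $n$. Then, as $n\to\infty$, $$E_n\sim \frac{\sqrt{5}}{5}\,n\approx 0.447214\, n.$$
   Context: A honeycomb strip of length $n$ consists of $n$ hexagons labelled $1,\dots,n$ in which hexagon $i$ is adjacent exactly with hexagons $i\pm1$ and $i\pm2$ (when these exist); equivalently its inner dual is the graph $P_n^2$ on vertices $1,\dots,n$ with $i\sim j$ iff $1\le|i-j|\le2$. $d_k(n)$ denotes the number of partitions of the hexagons into exactly $k$ blocks each inducing a connected subgraph of $P_n^2$. All divisions are equally likely. -}

module Defs where

open import Data.Nat using (ℕ; zero; suc; _+_; _*_; _∸_; _⊔_; _≤ᵇ_; _≡ᵇ_)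
open import Data.Bool using (Bool; true; false; _∧_; _∨_; if_then_else_)
open import Data.List using (List; []; _∷_; map; concatMap; upTo; filter; length)
open import Data.Bool.ListAction using (any; all)
open import Data.Nat.ListAction using (sum)
open import Data.Product using (_×_; _,_; proj₁; proj₂)
open import Relation.Nullary.Decidable using (does)
open import Data.Bool.Properties using (T?)
open import Data.Bool using (T)

-- The graph P_n^2: i ~ j iff 1 ≤ |i - j| ≤ 2 (hexagons labelled 0..n-1)

absDiff : ℕ → ℕ → ℕ
absDiff i j = (i ∸ j) ⊔ (j ∸ i)

adj : ℕ → ℕ → Bool
adj i j = (1 ≤ᵇ absDiff i j) ∧ (absDiff i j ≤ᵇ 2)

elem : ℕ → List ℕ → Bool
elem x = any (λ y → x ≡ᵇ y)

step : List ℕ → List ℕ → List ℕ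
step S R = filter (λ x → T? (elem x R ∨ any (adj x) R)) S

reach : ℕ → List ℕ → List ℕ → List ℕ
reach zero    S R = R
reach (suc t) S R = reach t S (step S R)

inducesConnected : List ℕ → Bool
inducesConnected []      = true
inducesConnected (x ∷ S) = all (λ y → elem y (reach (length (x ∷ S)) (x ∷ S) (x ∷ []))) (x ∷ S)

-- Set partitions of {0,…,n-1} encoded by restricted growth strings:
-- a labelling a₀ a₁ … a_{n-1} with a_i ≤ (number of labels used before i);
-- these are in bijection with set partitions.

-- gen r m : all continuations of length r when m labels are already used,
-- together with the final number of labels.
gen : ℕ → ℕ → List (List ℕ × ℕ)
gen zero    m = ([] , m) ∷ []
gen (suc r) m =
  concatMap (λ c → map (λ p → (c ∷ proj₁ p) , proj₂ p)
                       (gen r (if c ≡ᵇ m then suc m else m)))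
            (upTo (suc m))

partitions : ℕ → List (List ℕ × ℕ)
partitions n = gen n 0

positionsFrom : ℕ → ℕ → List ℕ → List ℕ
positionsFrom b i []       = []
positionsFrom b i (a ∷ as) =
  if a ≡ᵇ b then i ∷ positionsFrom b (suc i) as else positionsFrom b (suc i) as

block : List ℕ → ℕ → List ℕ
block labels b = positionsFrom b 0 labels

allBlocksConnected : List ℕ × ℕ → Bool
allBlocksConnected (labels , k) = all (λ b → inducesConnected (block labels b)) (upTo k)

d : ℕ → ℕ → ℕ
d k n = length (filter (λ p → T? (allBlocksConnected p ∧ (proj₂ p ≡ᵇ k))) (partitions n))

D : ℕ → ℕ
D n = sum (map (λ k → d k n) (upTo (suc n)))

S : ℕ → ℕ
S n = sum (map (λ k → k * d k n) (upTo (suc n)))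

module Submission where

-- A set of hexagons is connected in P_n² iff its consecutive elements are at most two apart,
-- so a division is connected iff every hexagon opens a new piece or joins the piece of one of
-- the two hexagons before it.  Scanning from the left, the number of ways to finish a division
-- thus depends only on whether the last two hexagons share a piece: these numbers satisfy
-- waysSame (r+1) = waysSame r + waysSplit r, waysSplit (r+1) = waysSame r + 2 waysSplit r,
-- and D (r+1) = waysSame r.  Counting pieces along the same recurrence gives
-- 5 S n = n X + c with X = 2 waysSplit − waysSame and 0 < c ≤ 4 D n, while Cassini's
-- identity becomes X² + 4 = 5 (D n)².  Hence S n / (n D n) = X / (5 D n) + O(1/n) → 1/√5.

open import Defs

module Estimates where

  open import Data.Empty using (⊥-elim)
  open import Data.Nat using (ℕ; zero; suc; _+_; _*_; _∸_; _≤_; _<_; s≤s; z≤n)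
  open import Data.Nat.Properties
  open import Data.Nat.Solver using (module +-*-Solver)
  open import Data.Sum using (inj₁; inj₂)
  open import Relation.Binary.PropositionalEquality
  open +-*-Solver

  square-<⇒< : ∀ {x y} → x * x < y * y → x < y
  square-<⇒< {x} {y} x²<y² with ≤-<-connex y x
  ... | inj₁ y≤x = ⊥-elim (<⇒≱ x²<y² (*-mono-≤ y≤x y≤x))
  ... | inj₂ x<y = x<y

  square-≤⇒≤ : ∀ {x y} → x * x ≤ y * y → x ≤ y
  square-≤⇒≤ {x} {y} x²≤y² with ≤-<-connex x y
  ... | inj₁ x≤y = x≤y
  ... | inj₂ y<x = ⊥-elim (<⇒≱ (*-mono-< y<x y<x) x²≤y²)

  -- With r = p ∸ z one has p² ≤ r² + 2pz, so the hypothesis forces y < r.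
  +-<-by-squares : ∀ {y z p} → z ≤ p → y * y + 2 * p * z < p * p → y + z < p
  +-<-by-squares {y} {z} {p} z≤p y²+2pz<p² = subst (y + z <_) r+z≡p (+-monoˡ-< z (square-<⇒< y²<r²))
    where
    open ≤-Reasoning
    r = p ∸ z
    r+z≡p : r + z ≡ p
    r+z≡p = m∸n+n≡m z≤p
    p²≤r²+2pz : p * p ≤ r * r + 2 * p * z
    p²≤r²+2pz = begin
      p * p                          ≡⟨ cong (λ t → t * t) (sym r+z≡p) ⟩
      (r + z) * (r + z)              ≡⟨ solve 2 (λ r z → (r :+ z) :* (r :+ z) := r :* r :+ con 2 :* r :* z :+ z :* z) refl r z ⟩
      r * r + 2 * r * z + z * z      ≤⟨ +-monoʳ-≤ (r * r + 2 * r * z) (m≤m+n (z * z) (z * z + 0)) ⟩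
      r * r + 2 * r * z + (z * z + (z * z + 0))
        ≡⟨ solve 2 (λ r z → r :* r :+ con 2 :* r :* z :+ (z :* z :+ (z :* z :+ con 0))
                         := r :* r :+ con 2 :* (r :+ z) :* z) refl r z ⟩
      r * r + 2 * (r + z) * z        ≡⟨ cong (λ t → r * r + 2 * t * z) r+z≡p ⟩
      r * r + 2 * p * z              ∎
    y²<r² : y * y < r * r
    y²<r² = +-cancelʳ-< (2 * p * z) (y * y) (r * r) (<-≤-trans y²+2pz<p² p²≤r²+2pz)

  -- s / (n u) = slope / (5 u) + offset / (5 n u), where slope / u → √5 as u grows.
  record PellAffine (n u s : ℕ) : Set where
    field
      slope offset  : ℕ
      affine        : 5 * s ≡ n * slope + offset
      pell          : slope * slope + 4 ≡ 5 * (u * u)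
      offset-pos    : 1 ≤ offset
      offset-bound  : offset ≤ 4 * u

  PellAffine⇒1≤s : ∀ {n u s} → PellAffine n u s → 1 ≤ s
  PellAffine⇒1≤s {s = suc _} _     = s≤s z≤n
  PellAffine⇒1≤s {n} {s = zero} shape =
    ⊥-elim (n≮0 (≤-trans offset-pos (subst (offset ≤_) (sym affine) (m≤n+m offset (n * slope)))))
    where open PellAffine shape

  squared-ratio-below : ∀ a b n u X c → 1 ≤ b → 1 ≤ n → b * b + 1 ≤ 5 * (a * a) → 8 * (a * b) ≤ n →
    X * X + 4 ≡ 5 * (u * u) → c ≤ 4 * u →
    (b * (n * X)) * (b * (n * X)) + 2 * (5 * (a * (n * u))) * (b * c) < (5 * (a * (n * u))) * (5 * (a * (n * u)))
  squared-ratio-below a b n u X c 1≤b 1≤n b²+1≤5a² 8ab≤n pell c≤4u = begin-strict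
    Y * Y + 2 * P * z
      <⟨ +-monoˡ-< (2 * P * z) (m<m+n (Y * Y) (*-mono-≤ (s≤s (z≤n {3})) (*-mono-≤ bn≥1 bn≥1))) ⟩
    Y * Y + 4 * ((b * n) * (b * n)) + 2 * P * z
      ≡⟨ cong (_+ 2 * P * z) Y²-pell ⟩
    5 * (b * n) * (b * n) * (u * u) + 2 * P * z
      ≡⟨ cong (5 * (b * n) * (b * n) * (u * u) +_)
              (solve 5 (λ a n u b c → con 2 :* (con 5 :* (a :* (n :* u))) :* (b :* c)
                                   := con 10 :* a :* n :* u :* b :* c) refl a n u b c) ⟩
    5 * (b * n) * (b * n) * (u * u) + 10 * a * n * u * b * c
      ≤⟨ +-monoʳ-≤ (5 * (b * n) * (b * n) * (u * u)) (*-monoʳ-≤ (10 * a * n * u * b) c≤4u) ⟩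
    5 * (b * n) * (b * n) * (u * u) + 10 * a * n * u * b * (4 * u)
      ≡⟨ solve 4 (λ a b n u → con 5 :* (b :* n) :* (b :* n) :* (u :* u) :+ con 10 :* a :* n :* u :* b :* (con 4 :* u)
                           := con 5 :* n :* (u :* u) :* (b :* b :* n :+ con 8 :* (a :* b))) refl a b n u ⟩
    5 * n * (u * u) * (b * b * n + 8 * (a * b))
      ≤⟨ *-monoʳ-≤ (5 * n * (u * u)) b²n+8ab≤5a²n ⟩
    5 * n * (u * u) * (5 * (a * a) * n)
      ≡⟨ solve 3 (λ a n u → con 5 :* n :* (u :* u) :* (con 5 :* (a :* a) :* n)
                         := (con 5 :* (a :* (n :* u))) :* (con 5 :* (a :* (n :* u)))) refl a n u ⟩
    P * P ∎
    where
    open ≤-Reasoning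
    P = 5 * (a * (n * u))
    Y = b * (n * X)
    z = b * c
    bn≥1 : 1 ≤ b * n
    bn≥1 = *-mono-≤ 1≤b 1≤n
    Y²-pell : Y * Y + 4 * ((b * n) * (b * n)) ≡ 5 * (b * n) * (b * n) * (u * u)
    Y²-pell = begin-equality
      Y * Y + 4 * ((b * n) * (b * n))
        ≡⟨ solve 3 (λ b n X → (b :* (n :* X)) :* (b :* (n :* X)) :+ con 4 :* ((b :* n) :* (b :* n))
                           := (b :* n) :* (b :* n) :* (X :* X :+ con 4)) refl b n X ⟩
      (b * n) * (b * n) * (X * X + 4)     ≡⟨ cong ((b * n) * (b * n) *_) pell ⟩
      (b * n) * (b * n) * (5 * (u * u))
        ≡⟨ solve 3 (λ b n u → (b :* n) :* (b :* n) :* (con 5 :* (u :* u))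
                           := con 5 :* (b :* n) :* (b :* n) :* (u :* u)) refl b n u ⟩
      5 * (b * n) * (b * n) * (u * u)     ∎
    b²n+8ab≤5a²n : b * b * n + 8 * (a * b) ≤ 5 * (a * a) * n
    b²n+8ab≤5a²n = begin
      b * b * n + 8 * (a * b) ≤⟨ +-monoʳ-≤ (b * b * n) 8ab≤n ⟩
      b * b * n + n           ≡⟨ solve 2 (λ b n → b :* b :* n :+ n := (b :* b :+ con 1) :* n) refl b n ⟩
      (b * b + 1) * n         ≤⟨ *-monoˡ-≤ n b²+1≤5a² ⟩
      5 * (a * a) * n         ∎

  ratio-below : ∀ {n u s} a b → PellAffine n u s → 1 ≤ a → 1 ≤ b → b * b + 1 ≤ 5 * (a * a) →
                8 * (a * b) ≤ n → 1 ≤ n →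
                s * b < a * (n * u)
  ratio-below {n} {u} {s} a b shape 1≤a 1≤b b²+1≤5a² 8ab≤n 1≤n = *-cancelˡ-< 5 (s * b) (a * (n * u)) (begin-strict
    5 * (s * b)           ≡⟨ solve 2 (λ s b → con 5 :* (s :* b) := b :* (con 5 :* s)) refl s b ⟩
    b * (5 * s)           ≡⟨ cong (b *_) affine ⟩
    b * (n * X + c)       ≡⟨ *-distribˡ-+ b (n * X) c ⟩
    b * (n * X) + b * c   <⟨ +-<-by-squares bc≤P (squared-ratio-below a b n u X c 1≤b 1≤n b²+1≤5a² 8ab≤n pell c≤4u) ⟩
    5 * (a * (n * u))     ∎)
    where
    open ≤-Reasoning
    open PellAffine shape renaming (slope to X; offset to c; offset-bound to c≤4u)
    b≤n : b ≤ n
    b≤n = ≤-trans (subst (_≤ a * b) (*-identityˡ b) (*-monoˡ-≤ b 1≤a)) (≤-trans (m≤n*m (a * b) 8) 8ab≤n)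
    bc≤P : b * c ≤ 5 * (a * (n * u))
    bc≤P = begin
      b * c       ≤⟨ *-mono-≤ b≤n c≤4u ⟩
      n * (4 * u) ≡⟨ solve 2 (λ n u → n :* (con 4 :* u) := con 4 :* (n :* u)) refl n u ⟩
      4 * (n * u) ≤⟨ *-monoˡ-≤ (n * u) (n≤1+n 4) ⟩
      5 * (n * u) ≤⟨ *-monoʳ-≤ 5 (subst (_≤ a * (n * u)) (*-identityˡ (n * u)) (*-monoˡ-≤ (n * u) 1≤a)) ⟩
      5 * (a * (n * u)) ∎

  ratio-above : ∀ {n u s} a b → PellAffine n u s → 1 ≤ b → 5 * (a * a) + 1 ≤ b * b → b ≤ n → n ≤ u →
                a * (n * u) < s * b
  ratio-above {n} {u} {s} a b shape 1≤b 5a²+1≤b² b≤n n≤u = *-cancelˡ-< 5 (a * (n * u)) (s * b) (begin-strict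
    5 * (a * (n * u)) ≡⟨ solve 3 (λ a n u → con 5 :* (a :* (n :* u)) := n :* (con 5 :* a :* u)) refl a n u ⟩
    n * (5 * a * u)   ≤⟨ *-monoʳ-≤ n (square-≤⇒≤ (+-cancelʳ-≤ (4 * (b * b)) _ _ squares)) ⟩
    n * (b * X)       <⟨ m<m+n (n * (b * X)) (*-mono-≤ 1≤b offset-pos) ⟩
    n * (b * X) + b * c ≡⟨ solve 4 (λ n b X c → n :* (b :* X) :+ b :* c := b :* (n :* X :+ c)) refl n b X c ⟩
    b * (n * X + c)   ≡⟨ cong (b *_) (sym affine) ⟩
    b * (5 * s)       ≡⟨ solve 2 (λ b s → b :* (con 5 :* s) := con 5 :* (s :* b)) refl b s ⟩
    5 * (s * b)       ∎)
    where
    open ≤-Reasoning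
    open PellAffine shape renaming (slope to X; offset to c)
    b²≤u² : b * b ≤ u * u
    b²≤u² = *-mono-≤ (≤-trans b≤n n≤u) (≤-trans b≤n n≤u)
    squares : (5 * a * u) * (5 * a * u) + 4 * (b * b) ≤ (b * X) * (b * X) + 4 * (b * b)
    squares = begin
      (5 * a * u) * (5 * a * u) + 4 * (b * b) ≤⟨ +-monoʳ-≤ ((5 * a * u) * (5 * a * u)) (*-monoʳ-≤ 4 b²≤u²) ⟩
      (5 * a * u) * (5 * a * u) + 4 * (u * u) ≤⟨ +-monoʳ-≤ ((5 * a * u) * (5 * a * u)) (*-monoˡ-≤ (u * u) (n≤1+n 4)) ⟩
      (5 * a * u) * (5 * a * u) + 5 * (u * u)
        ≡⟨ solve 2 (λ a u → (con 5 :* a :* u) :* (con 5 :* a :* u) :+ con 5 :* (u :* u)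
                         := con 5 :* (u :* u) :* (con 5 :* (a :* a) :+ con 1)) refl a u ⟩
      5 * (u * u) * (5 * (a * a) + 1)         ≤⟨ *-monoʳ-≤ (5 * (u * u)) 5a²+1≤b² ⟩
      5 * (u * u) * (b * b)                   ≡⟨ *-comm (5 * (u * u)) (b * b) ⟩
      (b * b) * (5 * (u * u))                 ≡⟨ cong (b * b *_) (sym pell) ⟩
      (b * b) * (X * X + 4)
        ≡⟨ solve 2 (λ b X → (b :* b) :* (X :* X :+ con 4) := (b :* X) :* (b :* X) :+ con 4 :* (b :* b)) refl b X ⟩
      (b * X) * (b * X) + 4 * (b * b)         ∎

module Enumeration where

  open import Data.Bool using (Bool; true; false; T; _∧_; not; if_then_else_)
  open import Data.Bool.Properties using (T?; T-≡; T-∧; T-∨; ∧-zeroʳ; ∧-inverseʳ)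
  open import Data.Empty using (⊥-elim)
  open import Data.List using (List; []; _∷_; _++_; length; filter; upTo; map; concatMap)
  open import Data.List.Properties using (upTo-∷ʳ; map-++)
  open import Data.List.Membership.Propositional using (_∈_; find)
  open import Data.List.Membership.Propositional.Properties using (∈-filter⁺; ∈-filter⁻; ∈-upTo⁺; ∈-upTo⁻)
  open import Data.List.Relation.Unary.All using (All; []; _∷_)
  import Data.List.Relation.Unary.All as All
  open import Data.List.Relation.Unary.All.Properties using (all⁺; all⁻; concat⁺; map⁺)
  import Data.List.Relation.Unary.Any as Any
  open import Data.List.Relation.Unary.Any using (here; there)
  open import Data.List.Relation.Unary.Any.Properties using (any⁺; any⁻)
  open import Data.List.Relation.Unary.Linked using (Linked; []; [-]; _∷_)
  open import Data.List.Relation.Unary.Linked.Properties using (Linked⇒All)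
  open import Data.Maybe using (Maybe; just; nothing)
  import Data.Maybe as Maybe
  open import Data.Maybe.Relation.Unary.All using (just; nothing) renaming (All to MaybeAll)
  open import Data.Nat using (ℕ; zero; suc; _+_; _*_; _∸_; _≤_; _<_; _≤ᵇ_; _≡ᵇ_; s≤s; z≤n; z<s; _≟_; _<?_)
  open import Data.Nat.ListAction using (sum)
  open import Data.Nat.ListAction.Properties using (sum-++)
  open import Data.Nat.Properties
  open import Data.Nat.Solver using (module +-*-Solver)
  open import Data.Product using (_×_; _,_; proj₁; proj₂; ∃-syntax)
  open import Data.Sum using (_⊎_; inj₁; inj₂)
  open import Data.Unit using (⊤)
  open import Function using (id; const; _∘_)
  open import Function.Bundles using (Equivalence)
  open import Relation.Binary.PropositionalEquality
  open import Relation.Nullary using (¬_; yes; no)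
  open +-*-Solver
  open Estimates using (PellAffine)

  T-injective : ∀ {x y} → (T x → T y) → (T y → T x) → x ≡ y
  T-injective {false} {false} _ _ = refl
  T-injective {false} {true}  _ g = ⊥-elim (g _)
  T-injective {true}  {false} f _ = ⊥-elim (f _)
  T-injective {true}  {true}  _ _ = refl

  ≡ᵇ-refl : ∀ n → (n ≡ᵇ n) ≡ true
  ≡ᵇ-refl n = Equivalence.to T-≡ (≡⇒≡ᵇ n n refl)

  ≢⇒≡ᵇ≡false : ∀ {m n} → m ≢ n → (m ≡ᵇ n) ≡ false
  ≢⇒≡ᵇ≡false {m} {n} m≢n with m ≡ᵇ n in eq
  ... | true  = ⊥-elim (m≢n (≡ᵇ⇒≡ m n (Equivalence.from T-≡ eq)))
  ... | false = refl

  >⇒≤ᵇ≡false : ∀ {m n} → n < m → (m ≤ᵇ n) ≡ false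
  >⇒≤ᵇ≡false {m} {n} n<m with m ≤ᵇ n in eq
  ... | true  = ⊥-elim (<⇒≱ n<m (≤ᵇ⇒≤ m n (Equivalence.from T-≡ eq)))
  ... | false = refl

  ≤⇒≤ᵇ≡true : ∀ {m n} → m ≤ n → (m ≤ᵇ n) ≡ true
  ≤⇒≤ᵇ≡true = Equivalence.to T-≡ ∘ ≤⇒≤ᵇ

  -- Connected vertex sets of P_n²

  ∈⇒elem : ∀ {x R} → x ∈ R → T (elem x R)
  ∈⇒elem = any⁺ _ ∘ Any.map (≡⇒≡ᵇ _ _)

  elem⇒∈ : ∀ {x} R → T (elem x R) → x ∈ R
  elem⇒∈ R = Any.map (≡ᵇ⇒≡ _ _) ∘ any⁻ _ R

  adj-above : ∀ {i j} → j < i → adj i j ≡ (i ∸ j ≤ᵇ 2)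
  adj-above {i} {j} j<i
    rewrite m≤n⇒m∸n≡0 (<⇒≤ j<i) | ⊔-identityʳ (i ∸ j) | ≤⇒≤ᵇ≡true (m<n⇒0<n∸m j<i) = refl

  adj-far : ∀ {r z} → r + 2 < z → ¬ T (adj z r)
  adj-far {r} {z} r+2<z adjzr = <⇒≱ (s≤s (≤ᵇ⇒≤ _ 2 close)) far
    where
    close : T (z ∸ r ≤ᵇ 2)
    close = subst T (adj-above (<-trans (m<m+n r z<s) r+2<z)) adjzr
    far : 3 ≤ z ∸ r
    far = subst (_≤ z ∸ r) (m+n∸m≡n r 3) (∸-monoˡ-≤ r (subst (_≤ z) (sym (+-suc r 2)) r+2<z))

  adjChainFrom : ℕ → List ℕ → Bool
  adjChainFrom j []       = true
  adjChainFrom j (x ∷ xs) = adj x j ∧ adjChainFrom x xs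

  adjChain : List ℕ → Bool
  adjChain []       = true
  adjChain (x ∷ xs) = adjChainFrom x xs

  module _ {S R : List ℕ} {y : ℕ} (y∈S : y ∈ S) where

    ∈-step-self : y ∈ R → y ∈ step S R
    ∈-step-self y∈R = ∈-filter⁺ (λ x → T? _) y∈S (Equivalence.from T-∨ (inj₁ (∈⇒elem y∈R)))

    ∈-step-adj : ∀ {r} → r ∈ R → T (adj y r) → y ∈ step S R
    ∈-step-adj r∈R adjyr =
      ∈-filter⁺ (λ x → T? _) y∈S (Equivalence.from T-∨ (inj₂ (any⁺ _ (Any.map (λ { refl → adjyr }) r∈R))))

  reach-mono : ∀ t {S R y} → y ∈ S → y ∈ R → y ∈ reach t S R
  reach-mono zero    y∈S y∈R = y∈R
  reach-mono (suc t) y∈S y∈R = reach-mono t y∈S (∈-step-self y∈S y∈R)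

  -- One more vertex of the chain joins the reached set in each round.
  reach-chain : ∀ {S R} u U → u ∈ R → All (_∈ S) (u ∷ U) → T (adjChainFrom u U) →
                All (_∈ reach (length (u ∷ U)) S R) (u ∷ U)
  reach-chain u []       u∈R (u∈S ∷ []) _ = ∈-step-self u∈S u∈R ∷ []
  reach-chain u (v ∷ U) u∈R (u∈S ∷ v∈S ∷ U⊆S) chain =
    reach-mono (length (u ∷ v ∷ U)) u∈S u∈R ∷
    reach-chain v U (∈-step-adj v∈S u∈R adjvu) (v∈S ∷ U⊆S) chain′
    where
    adjvu : T (adj v u)
    adjvu = proj₁ (Equivalence.to T-∧ chain)
    chain′ : T (adjChainFrom v U)
    chain′ = proj₂ (Equivalence.to (T-∧ {adj v u}) chain)

  SeparatedAt : ℕ → List ℕ → Set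
  SeparatedAt f = All (λ z → z ≤ f ⊎ f + 2 < z)

  reach-below : ∀ {f S} → SeparatedAt f S → ∀ t {R} → All (_≤ f) R → All (_≤ f) (reach t S R)
  reach-below sep zero    R≤f = R≤f
  reach-below {f} {S} sep (suc t) {R} R≤f = reach-below sep t (All.tabulate step-below)
    where
    step-below : ∀ {z} → z ∈ step S R → z ≤ f
    step-below z∈ with ∈-filter⁻ (λ x → T? _) {xs = S} z∈
    ... | z∈S , new with All.lookup sep z∈S | Equivalence.to T-∨ new
    ... | inj₁ z≤f | _       = z≤f
    ... | inj₂ far | inj₁ el = ⊥-elim (<⇒≱ (<-trans (m<m+n f z<s) far) (All.lookup R≤f (elem⇒∈ R el)))
    ... | inj₂ far | inj₂ an with find (any⁻ _ R an)
    ... | r , r∈R , adjzr = ⊥-elim (adj-far (≤-<-trans (+-monoˡ-≤ 2 (All.lookup R≤f r∈R)) far) adjzr)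

  chain-break : ∀ {j} xs → Linked _<_ (j ∷ xs) → ¬ T (adjChainFrom j xs) →
                ∃[ f ] j ≤ f × SeparatedAt f xs × ∃[ z ] z ∈ xs × f + 2 < z
  chain-break []       _           broken = ⊥-elim (broken _)
  chain-break {j} (x ∷ xs) (j<x ∷ asc) broken with T? (adj x j)
  ... | yes adjxj =
    let f , x≤f , sep , z , z∈xs , far = chain-break xs asc (λ chain → broken (Equivalence.from T-∧ (adjxj , chain)))
    in f , ≤-trans (<⇒≤ j<x) x≤f , inj₁ x≤f ∷ sep , z , there z∈xs , far
  ... | no ¬adjxj = j , ≤-refl , All.map inj₂ above , x , here refl , All.head above
    where
    j+2<x : j + 2 < x
    j+2<x with ≤-<-connex x (j + 2)
    ... | inj₂ lt = lt
    ... | inj₁ x≤j+2 = ⊥-elim (¬adjxj (subst T (sym (adj-above j<x))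
            (≤⇒≤ᵇ (subst (x ∸ j ≤_) (m+n∸m≡n j 2) (∸-monoˡ-≤ j x≤j+2)))))
    above : All (j + 2 <_) (x ∷ xs)
    above = Linked⇒All <-trans j+2<x asc

  inducesConnected-ascending : ∀ {xs} → Linked _<_ xs → inducesConnected xs ≡ adjChain xs
  inducesConnected-ascending {[]}     _   = refl
  inducesConnected-ascending {x ∷ xs} asc = T-injective connected⇒chain chain⇒connected
    where
    chain⇒connected : T (adjChainFrom x xs) → T (inducesConnected (x ∷ xs))
    chain⇒connected chain = all⁻ _ (All.map ∈⇒elem
      (reach-chain {S = x ∷ xs} {R = x ∷ []} x xs (here refl) (All.tabulate (λ y∈ → y∈)) chain))
    connected⇒chain : T (inducesConnected (x ∷ xs)) → T (adjChainFrom x xs)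
    connected⇒chain conn with T? (adjChainFrom x xs)
    ... | yes chain = chain
    ... | no broken with chain-break xs asc broken
    ... | f , x≤f , sep , z , z∈xs , far = ⊥-elim (<⇒≱ (<-trans (m<m+n f z<s) far) (All.lookup below z∈R))
      where
      below = reach-below (inj₁ x≤f ∷ sep) (length (x ∷ xs)) (x≤f ∷ [])
      z∈R = elem⇒∈ _ (All.lookup (all⁺ _ (x ∷ xs) conn) (there z∈xs))

  -- The local criterion for a labelling

  withinTwo : Maybe ℕ → Bool
  withinTwo nothing  = true
  withinTwo (just a) = a ≤ᵇ 2

  -- The first argument is the number of steps since label b last occurred, if it has.
  revisitsWithinTwo : Maybe ℕ → ℕ → List ℕ → Bool
  revisitsWithinTwo a b []      = true
  revisitsWithinTwo a b (c ∷ L) =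
    if c ≡ᵇ b then withinTwo a ∧ revisitsWithinTwo (just 1) b L
              else revisitsWithinTwo (Maybe.map suc a) b L

  positions-ascending-from : ∀ b {i j} L → j < i → Linked _<_ (j ∷ positionsFrom b i L)
  positions-ascending-from b []      j<i = [-]
  positions-ascending-from b (c ∷ L) j<i with c ≡ᵇ b
  ... | true  = j<i ∷ positions-ascending-from b L (n<1+n _)
  ... | false = positions-ascending-from b L (m<n⇒m<1+n j<i)

  positions-ascending : ∀ b i L → Linked _<_ (positionsFrom b i L)
  positions-ascending b i []      = []
  positions-ascending b i (c ∷ L) with c ≡ᵇ b
  ... | true  = positions-ascending-from b L (n<1+n i)
  ... | false = positions-ascending b (suc i) L

  positions-chainFrom : ∀ b {i j} L → j < i →
    adjChainFrom j (positionsFrom b i L) ≡ revisitsWithinTwo (just (i ∸ j)) b L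
  positions-chainFrom b []      j<i = refl
  positions-chainFrom b {i} {j} (c ∷ L) j<i with c ≡ᵇ b
  ... | true  = cong₂ _∧_ (adj-above j<i)
                  (trans (positions-chainFrom b L (n<1+n i)) (cong (λ k → revisitsWithinTwo (just k) b L) (m+n∸n≡m 1 i)))
  ... | false = trans (positions-chainFrom b L (m<n⇒m<1+n j<i))
                  (cong (λ k → revisitsWithinTwo (just k) b L) (+-∸-assoc 1 (<⇒≤ j<i)))

  positions-chain : ∀ b i L → adjChain (positionsFrom b i L) ≡ revisitsWithinTwo nothing b L
  positions-chain b i []      = refl
  positions-chain b i (c ∷ L) with c ≡ᵇ b
  ... | true  = trans (positions-chainFrom b L (n<1+n i)) (cong (λ k → revisitsWithinTwo (just k) b L) (m+n∸n≡m 1 i))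
  ... | false = positions-chain b (suc i) L

  block-connected : ∀ L b → inducesConnected (block L b) ≡ revisitsWithinTwo nothing b L
  block-connected L b = trans (inducesConnected-ascending (positions-ascending b 0 L)) (positions-chain b 0 L)

  matches : ℕ → Maybe ℕ → Bool
  matches b nothing  = false
  matches b (just a) = b ≡ᵇ a

  grow : ℕ → ℕ → ℕ
  grow m c = if c ≡ᵇ m then suc m else m

  -- The age of label b after a prefix that used m labels and ended with the labels q, p.
  -- Ages beyond two only need to be recognised as such, so they are all recorded as 3.
  ageIn : ℕ → Maybe ℕ → Maybe ℕ → ℕ → Maybe ℕ
  ageIn m p q b =
    if m ≤ᵇ b then nothing
    else if matches b p then just 1
    else if matches b q then just 2
    else just 3

  locallyConnected : ℕ → Maybe ℕ → Maybe ℕ → List ℕ → Bool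
  locallyConnected m p q []      = true
  locallyConnected m p q (c ∷ L) = withinTwo (ageIn m p q c) ∧ locallyConnected (grow m c) (just c) p L

  RestrictedGrowth : ℕ → List ℕ → Set
  RestrictedGrowth m []      = ⊤
  RestrictedGrowth m (c ∷ L) = c ≤ m × RestrictedGrowth (grow m c) L

  labelCount : ℕ → List ℕ → ℕ
  labelCount m []      = m
  labelCount m (c ∷ L) = labelCount (grow m c) L

  m≤grow : ∀ m c → m ≤ grow m c
  m≤grow m c with c ≡ᵇ m
  ... | true  = n≤1+n m
  ... | false = ≤-refl

  <grow : ∀ {m c} → c ≤ m → c < grow m c
  <grow {m} {c} c≤m with c ≡ᵇ m in eq
  ... | true  = s≤s c≤m
  ... | false = ≤∧≢⇒< c≤m (λ c≡m → subst T eq (≡⇒≡ᵇ c m c≡m))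

  grow≤ : ∀ m c → grow m c ≤ suc m
  grow≤ m c with c ≡ᵇ m
  ... | true  = ≤-refl
  ... | false = n≤1+n m

  <grow⇒< : ∀ {m c b} → c ≤ m → b ≢ c → b < grow m c → b < m
  <grow⇒< {m} {c} {b} c≤m b≢c b<grow with c ≡ᵇ m in eq
  ... | true  = ≤∧≢⇒< (≤-pred b<grow) (λ b≡m → b≢c (trans b≡m (sym (≡ᵇ⇒≡ c m (Equivalence.from T-≡ eq)))))
  ... | false = b<grow

  revisits-here : ∀ a c L → revisitsWithinTwo a c (c ∷ L) ≡ withinTwo a ∧ revisitsWithinTwo (just 1) c L
  revisits-here a c L rewrite ≡ᵇ-refl c = refl

  revisits-other : ∀ a {b c} L → b ≢ c → revisitsWithinTwo a b (c ∷ L) ≡ revisitsWithinTwo (Maybe.map suc a) b L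
  revisits-other a L b≢c rewrite ≢⇒≡ᵇ≡false (b≢c ∘ sym) = refl

  revisits-age≥3 : ∀ a b L → revisitsWithinTwo (just (3 + a)) b L ≡ revisitsWithinTwo (just 3) b L
  revisits-age≥3 a b []      = refl
  revisits-age≥3 a b (c ∷ L) with c ≡ᵇ b
  ... | true  = refl
  ... | false = trans (revisits-age≥3 (suc a) b L) (sym (revisits-age≥3 1 b L))

  ageIn-self : ∀ {m} c p → c ≤ m → ageIn (grow m c) (just c) p c ≡ just 1
  ageIn-self c p c≤m rewrite >⇒≤ᵇ≡false (<grow c≤m) | ≡ᵇ-refl c = refl

  ageIn-step : ∀ {m c b} p q L → c ≤ m → b ≢ c →
    revisitsWithinTwo (Maybe.map suc (ageIn m p q b)) b L ≡ revisitsWithinTwo (ageIn (grow m c) (just c) p b) b L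
  ageIn-step {m} {c} {b} p q L c≤m b≢c with grow m c ≤ᵇ b in eq
  ... | true rewrite ≤⇒≤ᵇ≡true (≤-trans (m≤grow m c) (≤ᵇ⇒≤ _ b (Equivalence.from T-≡ eq))) = refl
  ... | false rewrite >⇒≤ᵇ≡false (<grow⇒< c≤m b≢c (≰⇒> (λ le → subst T eq (≤⇒≤ᵇ le)))) | ≢⇒≡ᵇ≡false b≢c
    with matches b p
  ... | true  = refl
  ... | false with matches b q
  ... | true  = refl
  ... | false = revisits-age≥3 1 b L

  local⇒revisits : ∀ {m p q} L → RestrictedGrowth m L → T (locallyConnected m p q L) →
                   ∀ b → T (revisitsWithinTwo (ageIn m p q b) b L)
  local⇒revisits []      _          _   b = _
  local⇒revisits {m} {p} {q} (c ∷ L) (c≤m , rg) loc b with Equivalence.to T-∧ loc | b ≟ c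
  ... | ok , loc′ | yes refl =
    subst T (sym (revisits-here (ageIn m p q b) b L)) (Equivalence.from T-∧ (ok ,
      subst (λ a → T (revisitsWithinTwo a b L)) (ageIn-self b p c≤m)
        (local⇒revisits {grow m c} {just c} {p} L rg loc′ b)))
  ... | _  , loc′ | no b≢c =
    subst T (sym (trans (revisits-other (ageIn m p q b) L b≢c) (ageIn-step p q L c≤m b≢c)))
      (local⇒revisits {grow m c} {just c} {p} L rg loc′ b)

  revisits⇒local : ∀ {m p q} L → RestrictedGrowth m L → (∀ b → T (revisitsWithinTwo (ageIn m p q b) b L)) →
                   T (locallyConnected m p q L)
  revisits⇒local []      _          _   = _
  revisits⇒local {m} {p} {q} (c ∷ L) (c≤m , rg) rev =
    Equivalence.from T-∧ (ok , revisits⇒local {grow m c} {just c} {p} L rg rev′)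
    where
    at-c : T (withinTwo (ageIn m p q c)) × T (revisitsWithinTwo (just 1) c L)
    at-c = Equivalence.to T-∧ (subst T (revisits-here (ageIn m p q c) c L) (rev c))
    ok = proj₁ at-c
    rev′ : ∀ b → T (revisitsWithinTwo (ageIn (grow m c) (just c) p b) b L)
    rev′ b with b ≟ c
    ... | yes refl = subst (λ a → T (revisitsWithinTwo a b L)) (sym (ageIn-self b p c≤m)) (proj₂ at-c)
    ... | no b≢c   = subst T (trans (revisits-other (ageIn m p q b) L b≢c) (ageIn-step p q L c≤m b≢c)) (rev b)

  labelCount-≥ : ∀ m L → m ≤ labelCount m L
  labelCount-≥ m []      = ≤-refl
  labelCount-≥ m (c ∷ L) = ≤-trans (m≤grow m c) (labelCount-≥ (grow m c) L)

  revisits-unused : ∀ {m b} a L → RestrictedGrowth m L → labelCount m L ≤ b → T (revisitsWithinTwo a b L)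
  revisits-unused a []      _          _ = _
  revisits-unused {m} {b} a (c ∷ L) (c≤m , rg) count≤b =
    subst T (sym (revisits-other a L b≢c)) (revisits-unused (Maybe.map suc a) L rg count≤b)
    where
    b≢c : b ≢ c
    b≢c refl = <⇒≱ (<-≤-trans (<grow c≤m) (labelCount-≥ (grow m c) L)) count≤b

  allBlocksConnected-local : ∀ L → RestrictedGrowth 0 L →
    allBlocksConnected (L , labelCount 0 L) ≡ locallyConnected 0 nothing nothing L
  allBlocksConnected-local L rg = T-injective blocks⇒local local⇒blocks
    where
    k = labelCount 0 L
    blocks⇒local : T (allBlocksConnected (L , k)) → T (locallyConnected 0 nothing nothing L)
    blocks⇒local conn = revisits⇒local {0} {nothing} {nothing} L rg revisits
      where
      revisits : ∀ b → T (revisitsWithinTwo nothing b L)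
      revisits b with b <? k
      ... | yes b<k = subst T (block-connected L b) (All.lookup (all⁺ _ (upTo k) conn) (∈-upTo⁺ b<k))
      ... | no b≮k  = revisits-unused nothing L rg (≮⇒≥ b≮k)
    local⇒blocks : T (locallyConnected 0 nothing nothing L) → T (allBlocksConnected (L , k))
    local⇒blocks loc = all⁻ _ {xs = upTo k} (All.tabulate (λ {b} _ →
      subst T (sym (block-connected L b)) (local⇒revisits {0} {nothing} {nothing} L rg loc b)))

  -- Counting divisions by their first label

  sumBelow : ℕ → (ℕ → ℕ) → ℕ
  sumBelow zero    f = 0
  sumBelow (suc n) f = sumBelow n f + f n

  infix 5 sumBelow
  syntax sumBelow n (λ k → e) = ∑[ k < n ] e

  sum-upTo : ∀ (f : ℕ → ℕ) n → sum (map f (upTo n)) ≡ ∑[ k < n ] f k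
  sum-upTo f zero    = refl
  sum-upTo f (suc n) = begin
    sum (map f (upTo (suc n)))        ≡⟨ cong (sum ∘ map f) (sym (upTo-∷ʳ n)) ⟩
    sum (map f (upTo n ++ n ∷ []))    ≡⟨ cong sum (map-++ f (upTo n) (n ∷ [])) ⟩
    sum (map f (upTo n) ++ f n ∷ [])  ≡⟨ sum-++ (map f (upTo n)) (f n ∷ []) ⟩
    sum (map f (upTo n)) + (f n + 0)  ≡⟨ cong₂ _+_ (sum-upTo f n) (+-identityʳ (f n)) ⟩
    (∑[ k < n ] f k) + f n            ∎
    where open ≡-Reasoning

  ∑-cong : ∀ {f g : ℕ → ℕ} n → (∀ {k} → k < n → f k ≡ g k) → ∑[ k < n ] f k ≡ ∑[ k < n ] g k
  ∑-cong zero    f≗g = refl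
  ∑-cong (suc n) f≗g = cong₂ _+_ (∑-cong n (f≗g ∘ m<n⇒m<1+n)) (f≗g (n<1+n n))

  ∑-+ : ∀ (f g : ℕ → ℕ) n → ∑[ k < n ] (f k + g k) ≡ (∑[ k < n ] f k) + (∑[ k < n ] g k)
  ∑-+ f g zero    = refl
  ∑-+ f g (suc n) rewrite ∑-+ f g n = +-+-swap (∑[ k < n ] f k) (∑[ k < n ] g k) (f n) (g n)
    where
    +-+-swap : ∀ a b c d → a + b + (c + d) ≡ a + c + (b + d)
    +-+-swap a b c d = solve 4 (λ a b c d → a :+ b :+ (c :+ d) := a :+ c :+ (b :+ d)) refl a b c d

  ∑-zero : ∀ (f : ℕ → ℕ) n → (∀ {k} → k < n → f k ≡ 0) → ∑[ k < n ] f k ≡ 0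
  ∑-zero f zero    f≗0 = refl
  ∑-zero f (suc n) f≗0 = cong₂ _+_ (∑-zero f n (f≗0 ∘ m<n⇒m<1+n)) (f≗0 (n<1+n n))

  ∑-single : ∀ (β : ℕ → Bool) (F : ℕ → ℕ) {j} n → (∀ {k} → T (β k) → k ≡ j) → T (β j) → j < n →
             ∑[ k < n ] (if β k then F k else 0) ≡ F j
  ∑-single β F {j} (suc n) only-j βj j<1+n with j ≟ n
  ... | yes refl rewrite Equivalence.to T-≡ βj = cong (_+ F j) (∑-zero _ n zero-below)
    where
    zero-below : ∀ {k} → k < j → (if β k then F k else 0) ≡ 0
    zero-below {k} k<j with β k in eq
    ... | true  = ⊥-elim (<⇒≢ k<j (only-j (Equivalence.from T-≡ eq)))
    ... | false = refl
  ... | no j≢n =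
    trans (cong₂ _+_ (∑-single β F n only-j βj (≤∧≢⇒< (≤-pred j<1+n) j≢n)) zero-at-n) (+-identityʳ (F j))
    where
    zero-at-n : (if β n then F n else 0) ≡ 0
    zero-at-n with β n in eq
    ... | true  = ⊥-elim (j≢n (sym (only-j (Equivalence.from T-≡ eq))))
    ... | false = refl

  Division : Set
  Division = List ℕ × ℕ

  countBy : (ℕ → ℕ) → (Division → Bool) → List Division → ℕ
  countBy w f []       = 0
  countBy w f (x ∷ xs) = (if f x then w (proj₂ x) else 0) + countBy w f xs

  length-filter : ∀ f xs → length (filter (λ x → T? (f x)) xs) ≡ countBy (const 1) f xs
  length-filter f []       = refl
  length-filter f (x ∷ xs) with f x
  ... | true  = cong suc (length-filter f xs)
  ... | false = length-filter f xs

  countBy-cong : ∀ w {f g} {xs} → All (λ x → f x ≡ g x) xs → countBy w f xs ≡ countBy w g xs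
  countBy-cong w []           = refl
  countBy-cong w (fx≡gx ∷ eq) = cong₂ _+_ (cong (λ b → if b then _ else 0) fx≡gx) (countBy-cong w eq)

  countBy-++ : ∀ w f xs ys → countBy w f (xs ++ ys) ≡ countBy w f xs + countBy w f ys
  countBy-++ w f []       ys = refl
  countBy-++ w f (x ∷ xs) ys =
    trans (cong (_ +_) (countBy-++ w f xs ys)) (sym (+-assoc (if f x then w (proj₂ x) else 0) _ _))

  countBy-concatMap : ∀ w f (F : ℕ → List Division) cs →
                      countBy w f (concatMap F cs) ≡ sum (map (λ c → countBy w f (F c)) cs)
  countBy-concatMap w f F []       = refl
  countBy-concatMap w f F (c ∷ cs) =
    trans (countBy-++ w f (F c) (concatMap F cs)) (cong (countBy w f (F c) +_) (countBy-concatMap w f F cs))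

  countBy-prepend : ∀ w f c ys → countBy w f (map (λ x → (c ∷ proj₁ x , proj₂ x)) ys)
                               ≡ countBy w (λ x → f (c ∷ proj₁ x , proj₂ x)) ys
  countBy-prepend w f c []       = refl
  countBy-prepend w f c (y ∷ ys) = cong (_ +_) (countBy-prepend w f c ys)

  countBy-∧ : ∀ w a f ys → countBy w (λ x → a ∧ f x) ys ≡ (if a then countBy w f ys else 0)
  countBy-∧ w true  f ys       = refl
  countBy-∧ w false f []       = refl
  countBy-∧ w false f (y ∷ ys) = countBy-∧ w false f ys

  ∑-countBy-blocks : ∀ (h : ℕ → ℕ) g N xs → All (λ x → proj₂ x ≤ N) xs →
    ∑[ k < suc N ] h k * countBy (const 1) (λ x → g x ∧ (proj₂ x ≡ᵇ k)) xs ≡ countBy h g xs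
  ∑-countBy-blocks h g N []       _ = ∑-zero _ (suc N) (λ {k} _ → *-zeroʳ (h k))
  ∑-countBy-blocks h g N (x ∷ xs) (x≤N ∷ xs≤N) = begin
    ∑[ k < suc N ] h k * ((if g x ∧ (proj₂ x ≡ᵇ k) then 1 else 0) + rest k)
      ≡⟨ ∑-cong (suc N) (λ {k} _ → *-distribˡ-+ (h k) _ (rest k)) ⟩
    ∑[ k < suc N ] (h k * (if g x ∧ (proj₂ x ≡ᵇ k) then 1 else 0) + h k * rest k)
      ≡⟨ ∑-+ _ _ (suc N) ⟩
    (∑[ k < suc N ] h k * (if g x ∧ (proj₂ x ≡ᵇ k) then 1 else 0)) + (∑[ k < suc N ] h k * rest k)
      ≡⟨ cong₂ _+_ own-term (∑-countBy-blocks h g N xs xs≤N) ⟩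
    (if g x then h (proj₂ x) else 0) + countBy h g xs
      ∎
    where
    open ≡-Reasoning
    rest : ℕ → ℕ
    rest k = countBy (const 1) (λ x → g x ∧ (proj₂ x ≡ᵇ k)) xs
    own-term : ∑[ k < suc N ] h k * (if g x ∧ (proj₂ x ≡ᵇ k) then 1 else 0) ≡ (if g x then h (proj₂ x) else 0)
    own-term with g x
    ... | false = ∑-zero _ (suc N) (λ {k} _ → *-zeroʳ (h k))
    ... | true  = trans (∑-cong (suc N) (λ {k} _ → h-indicator k))
                    (∑-single (proj₂ x ≡ᵇ_) h (suc N) (λ {k} → sym ∘ ≡ᵇ⇒≡ (proj₂ x) k)
                              (≡⇒≡ᵇ (proj₂ x) (proj₂ x) refl) (s≤s x≤N))
      where
      h-indicator : ∀ k → h k * (if proj₂ x ≡ᵇ k then 1 else 0) ≡ (if proj₂ x ≡ᵇ k then h k else 0)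
      h-indicator k with proj₂ x ≡ᵇ k
      ... | true  = *-identityʳ (h k)
      ... | false = *-zeroʳ (h k)

  WellFormed : ℕ → ℕ → Division → Set
  WellFormed r m (L , k) = RestrictedGrowth m L × k ≡ labelCount m L × k ≤ r + m

  gen-wellFormed : ∀ r m → All (WellFormed r m) (gen r m)
  gen-wellFormed zero    m = (_ , refl , ≤-refl) ∷ []
  gen-wellFormed (suc r) m =
    concat⁺ (map⁺ (All.tabulate (λ {c} c∈ →
      map⁺ (All.map (extend (≤-pred (∈-upTo⁻ c∈))) (gen-wellFormed r (grow m c))))))
    where
    extend : ∀ {c x} → c ≤ m → WellFormed r (grow m c) x → WellFormed (suc r) m (c ∷ proj₁ x , proj₂ x)
    extend {c} c≤m (rg , k≡count , k≤) =
      (c≤m , rg) , k≡count , ≤-trans k≤ (≤-trans (+-monoʳ-≤ r (grow≤ m c)) (≤-reflexive (+-suc r m)))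

  locallyConnectedDivision : Division → Bool
  locallyConnectedDivision x = locallyConnected 0 nothing nothing (proj₁ x)

  ∑-d : ∀ (h : ℕ → ℕ) n → ∑[ k < suc n ] h k * d k n ≡ countBy h locallyConnectedDivision (gen n 0)
  ∑-d h n = begin
    ∑[ k < suc n ] h k * d k n
      ≡⟨ ∑-cong (suc n) (λ {k} _ → cong (h k *_) (length-filter _ (gen n 0))) ⟩
    ∑[ k < suc n ] h k * countBy (const 1) (λ x → allBlocksConnected x ∧ (proj₂ x ≡ᵇ k)) (gen n 0)
      ≡⟨ ∑-countBy-blocks h allBlocksConnected n (gen n 0)
           (All.map (λ (_ , _ , k≤) → ≤-trans k≤ (≤-reflexive (+-identityʳ n))) valid) ⟩
    countBy h allBlocksConnected (gen n 0)
      ≡⟨ countBy-cong h (All.map (λ { {L , _} (rg , refl , _) → allBlocksConnected-local L rg }) valid) ⟩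
    countBy h locallyConnectedDivision (gen n 0)
      ∎
    where
    open ≡-Reasoning
    valid = gen-wellFormed n 0

  D-count : ∀ n → D n ≡ countBy (const 1) locallyConnectedDivision (gen n 0)
  D-count n = trans (sum-upTo _ (suc n)) (trans (∑-cong (suc n) (λ {k} _ → sym (*-identityˡ (d k n)))) (∑-d (const 1) n))

  S-count : ∀ n → S n ≡ countBy id locallyConnectedDivision (gen n 0)
  S-count n = trans (sum-upTo _ (suc n)) (∑-d id n)

  extensions : (ℕ → ℕ) → ℕ → ℕ → Maybe ℕ → Maybe ℕ → ℕ
  extensions w r m p q = countBy w (λ x → locallyConnected m p q (proj₁ x)) (gen r m)

  extensions-suc : ∀ w r m p q → extensions w (suc r) m p q ≡
    ∑[ c < suc m ] (if withinTwo (ageIn m p q c) then extensions w r (grow m c) (just c) p else 0)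
  extensions-suc w r m p q = begin
    countBy w f (concatMap F (upTo (suc m)))            ≡⟨ countBy-concatMap w f F (upTo (suc m)) ⟩
    sum (map (λ c → countBy w f (F c)) (upTo (suc m)))  ≡⟨ sum-upTo (λ c → countBy w f (F c)) (suc m) ⟩
    ∑[ c < suc m ] countBy w f (F c)                    ≡⟨ ∑-cong (suc m) (λ {c} _ → first-label c) ⟩
    ∑[ c < suc m ] (if withinTwo (ageIn m p q c) then extensions w r (grow m c) (just c) p else 0) ∎
    where
    open ≡-Reasoning
    f : Division → Bool
    f x = locallyConnected m p q (proj₁ x)
    F : ℕ → List Division
    F c = map (λ x → (c ∷ proj₁ x , proj₂ x)) (gen r (grow m c))
    first-label : ∀ c → countBy w f (F c) ≡ (if withinTwo (ageIn m p q c) then extensions w r (grow m c) (just c) p else 0)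
    first-label c = trans (countBy-prepend w f c (gen r (grow m c)))
      (countBy-∧ w (withinTwo (ageIn m p q c)) (λ x → locallyConnected (grow m c) (just c) p (proj₁ x)) (gen r (grow m c)))

  -- The transfer recurrence

  lastTwoDiffer : ℕ → Maybe ℕ → Bool
  lastTwoDiffer a nothing  = false
  lastTwoDiffer a (just b) = not (b ≡ᵇ a)

  matches-fresh : ∀ {m} q → MaybeAll (_< m) q → matches m q ≡ false
  matches-fresh nothing  nothing      = refl
  matches-fresh (just b) (just b<m) = ≢⇒≡ᵇ≡false (<⇒≢ b<m ∘ sym)

  ∑-secondLast : ∀ {m a} X q → MaybeAll (_< m) q →
    ∑[ c < suc m ] (if matches c q ∧ not (c ≡ᵇ a) then X else 0) ≡ (if lastTwoDiffer a q then X else 0)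
  ∑-secondLast {m} X nothing  _ = ∑-zero _ (suc m) (λ _ → refl)
  ∑-secondLast {m} {a} X (just b) (just b<m) with b ≟ a
  ... | yes refl rewrite ≡ᵇ-refl b =
    ∑-zero _ (suc m) (λ {c} _ → cong (λ x → if x then X else 0) (∧-inverseʳ (c ≡ᵇ b)))
  ... | no b≢a rewrite ≢⇒≡ᵇ≡false b≢a =
    ∑-single (λ c → (c ≡ᵇ b) ∧ not (c ≡ᵇ a)) _ (suc m)
      (λ {c} e → ≡ᵇ⇒≡ c b (proj₁ (Equivalence.to T-∧ e)))
      (Equivalence.from T-∧ (≡⇒≡ᵇ b b refl , subst (T ∘ not) (sym (≢⇒≡ᵇ≡false b≢a)) _))
      (m<n⇒m<1+n b<m)

  -- The Boolean state of V records whether the last two labels differ.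
  module Transfer (w : ℕ → ℕ) (V : ℕ → ℕ → Bool → ℕ)
    (V-zero  : ∀ m s → V 0 m s ≡ w m)
    (V-same  : ∀ r m → V (suc r) m false ≡ V r (suc m) true + V r m false)
    (V-split : ∀ r m → V (suc r) m true ≡ V r (suc m) true + V r m false + V r m true)
    where

    Solves : ℕ → Set
    Solves r = ∀ {m a} q → a < m → MaybeAll (_< m) q → extensions w r m (just a) q ≡ V r m (lastTwoDiffer a q)

    module _ {r m a} (ih : Solves r) (q : Maybe ℕ) (a<m : a < m) (q<m : MaybeAll (_< m) q) where

      -- The next label is new (c = m), repeats the last one (c = a) or the one before it;
      -- any other label was last used too far back.
      transition : ∀ {c} → c ≤ m →
        (if withinTwo (ageIn m (just a) q c) then extensions w r (grow m c) (just c) (just a) else 0)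
        ≡ (if c ≡ᵇ m then V r (suc m) true else 0)
          + ((if c ≡ᵇ a then V r m false else 0) + (if matches c q ∧ not (c ≡ᵇ a) then V r m true else 0))
      transition {c} c≤m with c ≟ m
      ... | yes refl
        rewrite ≤⇒≤ᵇ≡true (≤-refl {c}) | ≡ᵇ-refl c | ≢⇒≡ᵇ≡false (<⇒≢ a<m ∘ sym) | matches-fresh q q<m
              | ih (just a) (n<1+n c) (just (m<n⇒m<1+n a<m)) | ≢⇒≡ᵇ≡false (<⇒≢ a<m)
        = sym (+-identityʳ _)
      ... | no c≢m with c<m ← ≤∧≢⇒< c≤m c≢m rewrite >⇒≤ᵇ≡false c<m | ≢⇒≡ᵇ≡false c≢m with c ≟ a
      ... | yes refl rewrite ≡ᵇ-refl c | ih (just c) c<m (just c<m) | ≡ᵇ-refl c | ∧-zeroʳ (matches c q)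
        = sym (+-identityʳ _)
      ... | no c≢a rewrite ≢⇒≡ᵇ≡false c≢a with matches c q
      ... | true  rewrite ih (just a) c<m (just a<m) | ≢⇒≡ᵇ≡false (c≢a ∘ sym) = refl
      ... | false = refl

    extensions-transfer : ∀ r → Solves r
    extensions-transfer zero    {m} q _ _ = trans (+-identityʳ (w m)) (sym (V-zero m _))
    extensions-transfer (suc r) {m} {a} q a<m q<m = begin
      extensions w (suc r) m (just a) q
        ≡⟨ extensions-suc w r m (just a) q ⟩
      ∑[ c < suc m ] (if withinTwo (ageIn m (just a) q c) then extensions w r (grow m c) (just c) (just a) else 0)
        ≡⟨ ∑-cong (suc m) (transition ih q a<m q<m ∘ ≤-pred) ⟩
      ∑[ c < suc m ] (new c + (last c + secondLast c))
        ≡⟨ ∑-+ new _ (suc m) ⟩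
      (∑[ c < suc m ] new c) + (∑[ c < suc m ] (last c + secondLast c))
        ≡⟨ cong ((∑[ c < suc m ] new c) +_) (∑-+ last secondLast (suc m)) ⟩
      (∑[ c < suc m ] new c) + ((∑[ c < suc m ] last c) + (∑[ c < suc m ] secondLast c))
        ≡⟨ cong₂ (λ x y → x + (y + (∑[ c < suc m ] secondLast c)))
             (∑-single (_≡ᵇ m) (λ _ → V r (suc m) true) (suc m) (λ {k} → ≡ᵇ⇒≡ k m) (≡⇒≡ᵇ m m refl) (n<1+n m))
             (∑-single (_≡ᵇ a) (λ _ → V r m false) (suc m) (λ {k} → ≡ᵇ⇒≡ k a) (≡⇒≡ᵇ a a refl) (m<n⇒m<1+n a<m)) ⟩
      V r (suc m) true + (V r m false + (∑[ c < suc m ] secondLast c))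
        ≡⟨ cong (λ x → V r (suc m) true + (V r m false + x)) (∑-secondLast (V r m true) q q<m) ⟩
      V r (suc m) true + (V r m false + (if lastTwoDiffer a q then V r m true else 0))
        ≡⟨ recombine (lastTwoDiffer a q) ⟩
      V (suc r) m (lastTwoDiffer a q)
        ∎
      where
      open ≡-Reasoning
      ih = extensions-transfer r
      new last secondLast : ℕ → ℕ
      new c = if c ≡ᵇ m then V r (suc m) true else 0
      last c = if c ≡ᵇ a then V r m false else 0
      secondLast c = if matches c q ∧ not (c ≡ᵇ a) then V r m true else 0
      recombine : ∀ s → V r (suc m) true + (V r m false + (if s then V r m true else 0)) ≡ V (suc r) m s
      recombine false = trans (cong (V r (suc m) true +_) (+-identityʳ _)) (sym (V-same r m))
      recombine true  = trans (sym (+-assoc (V r (suc m) true) (V r m false) (V r m true))) (sym (V-split r m))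

  waysSame waysSplit piecesSame piecesSplit : ℕ → ℕ
  waysSame zero    = 1
  waysSame (suc r) = waysSplit r + waysSame r
  waysSplit zero    = 1
  waysSplit (suc r) = waysSplit r + waysSame r + waysSplit r
  piecesSame zero    = 0
  piecesSame (suc r) = waysSplit r + piecesSplit r + piecesSame r
  piecesSplit zero    = 0
  piecesSplit (suc r) = waysSplit r + piecesSplit r + piecesSame r + piecesSplit r

  ways : ℕ → ℕ → Bool → ℕ
  ways r _ s = if s then waysSplit r else waysSame r

  -- The m pieces opened before the extension count once for each of its ways.
  pieces : ℕ → ℕ → Bool → ℕ
  pieces r m s = m * ways r m s + (if s then piecesSplit r else piecesSame r)

  ways-zero : ∀ m s → ways 0 m s ≡ 1
  ways-zero _ false = refl
  ways-zero _ true  = refl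

  ways-same : ∀ r m → ways (suc r) m false ≡ ways r (suc m) true + ways r m false
  ways-same _ _ = refl

  ways-split : ∀ r m → ways (suc r) m true ≡ ways r (suc m) true + ways r m false + ways r m true
  ways-split _ _ = refl

  module CountWays = Transfer (const 1) ways ways-zero ways-same ways-split

  pieces-zero : ∀ m s → pieces 0 m s ≡ m
  pieces-zero m false = trans (+-identityʳ (m * 1)) (*-identityʳ m)
  pieces-zero m true  = trans (+-identityʳ (m * 1)) (*-identityʳ m)

  pieces-same : ∀ r m → pieces (suc r) m false ≡ pieces r (suc m) true + pieces r m false
  pieces-same r m = solve 5 (λ m w u σ τ → m :* (w :+ u) :+ (w :+ σ :+ τ) := ((con 1 :+ m) :* w :+ σ) :+ (m :* u :+ τ))
                      refl m (waysSplit r) (waysSame r) (piecesSplit r) (piecesSame r)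

  pieces-split : ∀ r m → pieces (suc r) m true ≡ pieces r (suc m) true + pieces r m false + pieces r m true
  pieces-split r m = solve 5 (λ m w u σ τ → m :* (w :+ u :+ w) :+ (w :+ σ :+ τ :+ σ)
                                          := ((con 1 :+ m) :* w :+ σ) :+ (m :* u :+ τ) :+ (m :* w :+ σ))
                       refl m (waysSplit r) (waysSame r) (piecesSplit r) (piecesSame r)

  module CountPieces = Transfer id pieces pieces-zero pieces-same pieces-split

  D-suc : ∀ r → D (suc r) ≡ waysSame r
  D-suc r = trans (D-count (suc r))
    (trans (extensions-suc (const 1) r 0 nothing nothing) (CountWays.extensions-transfer r nothing z<s nothing))

  S-suc : ∀ r → S (suc r) ≡ waysSame r + piecesSame r
  S-suc r = trans (S-count (suc r)) (trans (extensions-suc id r 0 nothing nothing)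
              (trans (CountPieces.extensions-transfer r nothing z<s nothing) (cong (_+ piecesSame r) (*-identityˡ (waysSame r)))))

  -- Closed forms

  pieces-closedForms : ∀ r →
    5 * piecesSame r + r * waysSame r + waysSame r ≡ 2 * r * waysSplit r + waysSplit r
    × 5 * piecesSplit r + 2 * waysSplit r ≡ 2 * r * waysSame r + r * waysSplit r + 2 * waysSame r
  pieces-closedForms zero    = refl , refl
  pieces-closedForms (suc r) = same , split
    where
    open ≡-Reasoning
    u = waysSame r
    w = waysSplit r
    ih-same = proj₁ (pieces-closedForms r)
    ih-split = proj₂ (pieces-closedForms r)
    same : 5 * piecesSame (suc r) + suc r * waysSame (suc r) + waysSame (suc r)
         ≡ 2 * suc r * waysSplit (suc r) + waysSplit (suc r)
    same = +-cancelʳ-≡ (r * u + u + 2 * w) _ _ (begin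
      5 * (w + piecesSplit r + piecesSame r) + suc r * (w + u) + (w + u) + (r * u + u + 2 * w)
        ≡⟨ solve 5 (λ r u w τ σ → con 5 :* (w :+ σ :+ τ) :+ (con 1 :+ r) :* (w :+ u) :+ (w :+ u) :+ (r :* u :+ u :+ con 2 :* w)
                  := con 5 :* w :+ (con 5 :* σ :+ con 2 :* w) :+ (con 5 :* τ :+ r :* u :+ u) :+ (r :+ con 2) :* (w :+ u))
             refl r u w (piecesSame r) (piecesSplit r) ⟩
      5 * w + (5 * piecesSplit r + 2 * w) + (5 * piecesSame r + r * u + u) + (r + 2) * (w + u)
        ≡⟨ cong₂ (λ x y → 5 * w + x + y + (r + 2) * (w + u)) ih-split ih-same ⟩
      5 * w + (2 * r * u + r * w + 2 * u) + (2 * r * w + w) + (r + 2) * (w + u)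
        ≡⟨ solve 3 (λ r u w → con 5 :* w :+ (con 2 :* r :* u :+ r :* w :+ con 2 :* u) :+ (con 2 :* r :* w :+ w) :+ (r :+ con 2) :* (w :+ u)
                  := con 2 :* (con 1 :+ r) :* (w :+ u :+ w) :+ (w :+ u :+ w) :+ (r :* u :+ u :+ con 2 :* w)) refl r u w ⟩
      2 * suc r * (w + u + w) + (w + u + w) + (r * u + u + 2 * w) ∎)
    split : 5 * piecesSplit (suc r) + 2 * waysSplit (suc r)
          ≡ 2 * suc r * waysSame (suc r) + suc r * waysSplit (suc r) + 2 * waysSame (suc r)
    split = +-cancelʳ-≡ (4 * w + r * u + u) _ _ (begin
      5 * (w + piecesSplit r + piecesSame r + piecesSplit r) + 2 * (w + u + w) + (4 * w + r * u + u)
        ≡⟨ solve 5 (λ r u w τ σ → con 5 :* (w :+ σ :+ τ :+ σ) :+ con 2 :* (w :+ u :+ w) :+ (con 4 :* w :+ r :* u :+ u)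
                  := con 5 :* w :+ con 2 :* (con 5 :* σ :+ con 2 :* w) :+ (con 5 :* τ :+ r :* u :+ u) :+ con 2 :* (w :+ u :+ w))
             refl r u w (piecesSame r) (piecesSplit r) ⟩
      5 * w + 2 * (5 * piecesSplit r + 2 * w) + (5 * piecesSame r + r * u + u) + 2 * (w + u + w)
        ≡⟨ cong₂ (λ x y → 5 * w + 2 * x + y + 2 * (w + u + w)) ih-split ih-same ⟩
      5 * w + 2 * (2 * r * u + r * w + 2 * u) + (2 * r * w + w) + 2 * (w + u + w)
        ≡⟨ solve 3 (λ r u w → con 5 :* w :+ con 2 :* (con 2 :* r :* u :+ r :* w :+ con 2 :* u) :+ (con 2 :* r :* w :+ w) :+ con 2 :* (w :+ u :+ w)
                  := con 2 :* (con 1 :+ r) :* (w :+ u) :+ (con 1 :+ r) :* (w :+ u :+ w) :+ con 2 :* (w :+ u) :+ (con 4 :* w :+ r :* u :+ u)) refl r u w ⟩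
      2 * suc r * (w + u) + suc r * (w + u + w) + 2 * (w + u) + (4 * w + r * u + u) ∎)

  ways-cassini : ∀ r → waysSplit r * waysSplit r + 1 ≡ waysSame r * waysSame r + waysSame r * waysSplit r
  ways-cassini zero    = refl
  ways-cassini (suc r) = begin
    (w + u + w) * (w + u + w) + 1
      ≡⟨ solve 2 (λ u w → (w :+ u :+ w) :* (w :+ u :+ w) :+ con 1
                        := (w :* w :+ con 1) :+ con 3 :* w :* w :+ con 4 :* w :* u :+ u :* u) refl u w ⟩
    (w * w + 1) + 3 * w * w + 4 * w * u + u * u
      ≡⟨ cong (λ x → x + 3 * w * w + 4 * w * u + u * u) (ways-cassini r) ⟩
    (u * u + u * w) + 3 * w * w + 4 * w * u + u * u
      ≡⟨ solve 2 (λ u w → (u :* u :+ u :* w) :+ con 3 :* w :* w :+ con 4 :* w :* u :+ u :* u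
                        := (w :+ u) :* (w :+ u) :+ (w :+ u) :* (w :+ u :+ w)) refl u w ⟩
    (w + u) * (w + u) + (w + u) * (w + u + w) ∎
    where
    open ≡-Reasoning
    u = waysSame r
    w = waysSplit r

  ways-bounds : ∀ r → waysSame r ≤ waysSplit r × waysSplit r ≤ waysSame r + waysSame r × suc r ≤ waysSame r
  ways-bounds zero    = ≤-refl , s≤s z≤n , ≤-refl
  ways-bounds (suc r) with ways-bounds r
  ... | u≤w , w≤2u , r<u =
    m≤m+n (waysSplit r + waysSame r) (waysSplit r) ,
    +-monoʳ-≤ (waysSplit r + waysSame r) (m≤m+n (waysSplit r) (waysSame r)) ,
    +-mono-≤ (≤-trans (≤-trans (s≤s z≤n) r<u) u≤w) r<u

  slope offset : ℕ → ℕ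
  slope r = 2 * waysSplit r ∸ waysSame r
  offset r = 5 * waysSame r ∸ waysSplit r

  slope+waysSame : ∀ r → slope r + waysSame r ≡ 2 * waysSplit r
  slope+waysSame r = m∸n+n≡m (≤-trans u≤w (m≤m+n (waysSplit r) (waysSplit r + 0)))
    where u≤w = proj₁ (ways-bounds r)

  offset+waysSplit : ∀ r → offset r + waysSplit r ≡ 5 * waysSame r
  offset+waysSplit r = m∸n+n≡m (≤-trans w≤2u (+-monoʳ-≤ u (m≤m+n u (u + (u + (u + 0))))))
    where
    u = waysSame r
    w≤2u = proj₁ (proj₂ (ways-bounds r))

  5*S-affine : ∀ r → 5 * S (suc r) ≡ suc r * slope r + offset r
  5*S-affine r = +-cancelʳ-≡ (suc r * u + w) _ _ (begin
    5 * S (suc r) + (suc r * u + w)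
      ≡⟨ cong (λ t → 5 * t + (suc r * u + w)) (S-suc r) ⟩
    5 * (u + piecesSame r) + (suc r * u + w)
      ≡⟨ solve 4 (λ r u w τ → con 5 :* (u :+ τ) :+ ((con 1 :+ r) :* u :+ w) := (con 5 :* τ :+ r :* u :+ u) :+ con 5 :* u :+ w)
           refl r u w (piecesSame r) ⟩
    (5 * piecesSame r + r * u + u) + 5 * u + w
      ≡⟨ cong (λ t → t + 5 * u + w) (proj₁ (pieces-closedForms r)) ⟩
    (2 * r * w + w) + 5 * u + w
      ≡⟨ solve 3 (λ r u w → (con 2 :* r :* w :+ w) :+ con 5 :* u :+ w := (con 1 :+ r) :* (con 2 :* w) :+ con 5 :* u) refl r u w ⟩
    suc r * (2 * w) + 5 * u
      ≡⟨ cong₂ (λ s t → suc r * s + t) (sym (slope+waysSame r)) (sym (offset+waysSplit r)) ⟩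
    suc r * (slope r + u) + (offset r + w)
      ≡⟨ solve 5 (λ r X u c w → (con 1 :+ r) :* (X :+ u) :+ (c :+ w) := (con 1 :+ r) :* X :+ c :+ ((con 1 :+ r) :* u :+ w))
           refl r (slope r) u (offset r) w ⟩
    suc r * slope r + offset r + (suc r * u + w) ∎)
    where
    open ≡-Reasoning
    u = waysSame r
    w = waysSplit r

  slope-pell : ∀ r → slope r * slope r + 4 ≡ 5 * (waysSame r * waysSame r)
  slope-pell r = +-cancelʳ-≡ (2 * X * u + u * u) _ _ (begin
    X * X + 4 + (2 * X * u + u * u)
      ≡⟨ solve 2 (λ X u → X :* X :+ con 4 :+ (con 2 :* X :* u :+ u :* u) := (X :+ u) :* (X :+ u) :+ con 4) refl X u ⟩
    (X + u) * (X + u) + 4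
      ≡⟨ cong (λ t → t * t + 4) (slope+waysSame r) ⟩
    (2 * w) * (2 * w) + 4
      ≡⟨ solve 1 (λ w → (con 2 :* w) :* (con 2 :* w) :+ con 4 := con 4 :* (w :* w :+ con 1)) refl w ⟩
    4 * (w * w + 1)
      ≡⟨ cong (4 *_) (ways-cassini r) ⟩
    4 * (u * u + u * w)
      ≡⟨ solve 2 (λ u w → con 4 :* (u :* u :+ u :* w) := con 4 :* (u :* u) :+ con 2 :* u :* (con 2 :* w)) refl u w ⟩
    4 * (u * u) + 2 * u * (2 * w)
      ≡⟨ cong (λ t → 4 * (u * u) + 2 * u * t) (sym (slope+waysSame r)) ⟩
    4 * (u * u) + 2 * u * (X + u)
      ≡⟨ solve 2 (λ X u → con 4 :* (u :* u) :+ con 2 :* u :* (X :+ u)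
                        := con 5 :* (u :* u) :+ (con 2 :* X :* u :+ u :* u)) refl X u ⟩
    5 * (u * u) + (2 * X * u + u * u) ∎)
    where
    open ≡-Reasoning
    X = slope r
    u = waysSame r
    w = waysSplit r

  offset-bounds : ∀ r → 1 ≤ offset r × offset r ≤ 4 * waysSame r
  offset-bounds r = 1≤c , c≤4u
    where
    u = waysSame r
    w = waysSplit r
    c = offset r
    c+w≡5u = offset+waysSplit r
    1≤c : 1 ≤ c
    1≤c = ≤-trans (≤-trans (s≤s z≤n) (proj₂ (proj₂ (ways-bounds r)))) (+-cancelʳ-≤ w u c (begin
      u + w         ≤⟨ +-monoʳ-≤ u (proj₁ (proj₂ (ways-bounds r))) ⟩
      u + (u + u)   ≤⟨ +-monoʳ-≤ u (m≤m+n (u + u) (u + u)) ⟩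
      u + (u + u + (u + u)) ≡⟨ solve 1 (λ u → u :+ (u :+ u :+ (u :+ u)) := con 5 :* u) refl u ⟩
      5 * u         ≡⟨ sym c+w≡5u ⟩
      c + w         ∎))
      where open ≤-Reasoning
    c≤4u : c ≤ 4 * u
    c≤4u = +-cancelʳ-≤ u c (4 * u) (begin
      c + u   ≤⟨ +-monoʳ-≤ c (proj₁ (ways-bounds r)) ⟩
      c + w   ≡⟨ c+w≡5u ⟩
      5 * u   ≡⟨ solve 1 (λ u → con 5 :* u := con 4 :* u :+ u) refl u ⟩
      4 * u + u ∎)
      where open ≤-Reasoning

  pellAffine : ∀ r → PellAffine (suc r) (D (suc r)) (S (suc r))
  pellAffine r rewrite D-suc r = record
    { slope        = slope r
    ; offset       = offset r
    ; affine       = 5*S-affine r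
    ; pell         = slope-pell r
    ; offset-pos   = proj₁ (offset-bounds r)
    ; offset-bound = proj₂ (offset-bounds r)
    }

  D-growth : ∀ r → suc r ≤ D (suc r)
  D-growth r = subst (suc r ≤_) (sym (D-suc r)) (proj₂ (proj₂ (ways-bounds r)))

open import Data.Empty using (⊥-elim)
open import Data.Integer using (+_; -[1+_])
open import Data.Nat using (ℕ; _≥_)
open import Data.Product using (_×_; _,_; ∃-syntax)
open import Data.Rational using (ℚ; mkℚ; _<_; _*_; _/_; 0ℚ; 1ℚ; ↥_; ↧_; ↧ₙ_; toℚᵘ; positive; negative)
open import Data.Rational.Properties using (toℚᵘ-cancel-<; toℚᵘ-mono-<; toℚᵘ-homo-*; toℚᵘ-fromℚᵘ)
open import Data.Sum using (_⊎_; inj₁; inj₂)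
open import Relation.Binary.PropositionalEquality
import Data.Integer as ℤ
import Data.Integer.Properties as ℤₚ
import Data.Nat as ℕ
import Data.Nat.Properties as ℕₚ
import Data.Rational.Unnormalised as ℚᵘ
import Data.Rational.Unnormalised.Properties as ℚᵘₚ
open Estimates using (PellAffine; PellAffine⇒1≤s; ratio-below; ratio-above)
open Enumeration using (pellAffine; D-growth)

-- Clearing denominators

toℚᵘ-ℕ/1 : ∀ s → toℚᵘ (+ s / 1) ℚᵘ.≃ ℚᵘ.mkℚᵘ (+ s) 0
toℚᵘ-ℕ/1 s = toℚᵘ-fromℚᵘ (ℚᵘ.mkℚᵘ (+ s) 0)

toℚᵘ-*ℕ/1 : ∀ p m → toℚᵘ (p * (+ m / 1)) ℚᵘ.≃ toℚᵘ p ℚᵘ.* ℚᵘ.mkℚᵘ (+ m) 0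
toℚᵘ-*ℕ/1 p m = ℚᵘₚ.≃-trans (toℚᵘ-homo-* p (+ m / 1)) (ℚᵘₚ.*-cong (ℚᵘₚ.≃-refl {toℚᵘ p}) (toℚᵘ-ℕ/1 m))

toℚᵘ-5** : ∀ p → toℚᵘ ((+ 5 / 1) * p * p) ℚᵘ.≃ (ℚᵘ.mkℚᵘ (+ 5) 0 ℚᵘ.* toℚᵘ p) ℚᵘ.* toℚᵘ p
toℚᵘ-5** p = ℚᵘₚ.≃-trans (toℚᵘ-homo-* ((+ 5 / 1) * p) p) (ℚᵘₚ.*-cong (toℚᵘ-homo-* (+ 5 / 1) p) (ℚᵘₚ.≃-refl {toℚᵘ p}))

*ℕ/1<ℕ/1 : ∀ p (m s : ℕ) → ↥ p ℤ.* + m ℤ.< + s ℤ.* ↧ p → p * (+ m / 1) < + s / 1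
*ℕ/1<ℕ/1 p@(mkℚ _ d _) m s cross = toℚᵘ-cancel-<
  (ℚᵘₚ.<-respˡ-≃ (ℚᵘₚ.≃-sym (toℚᵘ-*ℕ/1 p m)) (ℚᵘₚ.<-respʳ-≃ (ℚᵘₚ.≃-sym (toℚᵘ-ℕ/1 s))
    (ℚᵘ.*<* (subst₂ ℤ._<_ (sym (ℤₚ.*-identityʳ _)) (cong (λ k → + s ℤ.* + ℕ.suc k) (sym (ℕₚ.*-identityʳ d))) cross))))

ℕ/1<*ℕ/1 : ∀ q (m s : ℕ) → + s ℤ.* ↧ q ℤ.< ↥ q ℤ.* + m → + s / 1 < q * (+ m / 1)
ℕ/1<*ℕ/1 q@(mkℚ _ d _) m s cross = toℚᵘ-cancel-<
  (ℚᵘₚ.<-respʳ-≃ (ℚᵘₚ.≃-sym (toℚᵘ-*ℕ/1 q m)) (ℚᵘₚ.<-respˡ-≃ (ℚᵘₚ.≃-sym (toℚᵘ-ℕ/1 s))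
    (ℚᵘ.*<* (subst₂ ℤ._<_ (cong (λ k → + s ℤ.* + ℕ.suc k) (sym (ℕₚ.*-identityʳ d))) (sym (ℤₚ.*-identityʳ _)) cross))))

5p²<1⇒ : ∀ p → (+ 5 / 1) * p * p < 1ℚ → + 5 ℤ.* ↥ p ℤ.* ↥ p ℤ.< ↧ p ℤ.* ↧ p
5p²<1⇒ p@(mkℚ _ d _) 5p²<1 with ℚᵘₚ.<-respˡ-≃ (toℚᵘ-5** p) (toℚᵘ-mono-< 5p²<1)
... | ℚᵘ.*<* cross = subst₂ ℤ._<_ (ℤₚ.*-identityʳ _) (trans (ℤₚ.*-identityˡ _) (cong (λ k → + (ℕ.suc k ℕ.* ℕ.suc d)) (ℕₚ.+-identityʳ d))) cross

1<5q²⇒ : ∀ q → 1ℚ < (+ 5 / 1) * q * q → ↧ q ℤ.* ↧ q ℤ.< + 5 ℤ.* ↥ q ℤ.* ↥ q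
1<5q²⇒ q@(mkℚ _ d _) 1<5q² with ℚᵘₚ.<-respʳ-≃ (toℚᵘ-5** q) (toℚᵘ-mono-< 1<5q²)
... | ℚᵘ.*<* cross = subst₂ ℤ._<_ (trans (ℤₚ.*-identityˡ _) (cong (λ k → + (ℕ.suc k ℕ.* ℕ.suc d)) (ℕₚ.+-identityʳ d))) (ℤₚ.*-identityʳ _) cross

+*+<+*+ : ∀ a b c d → a ℕ.* b ℕ.< c ℕ.* d → + a ℤ.* + b ℤ.< + c ℤ.* + d
+*+<+*+ a b c d ab<cd = subst₂ ℤ._<_ (ℤₚ.pos-* a b) (ℤₚ.pos-* c d) (ℤ.+<+ ab<cd)

lower-bound : ∀ p → (p < 0ℚ ⊎ (+ 5 / 1) * p * p < 1ℚ) → ∀ {n u s} → PellAffine n u s →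
              ↧ₙ p ℕ.≤ n → n ℕ.≤ u → p * (+ (n ℕ.* u) / 1) < + s / 1
lower-bound p@(mkℚ -[1+ k ] d _) _ {n} {u} {s} shape _ _ = *ℕ/1<ℕ/1 p (n ℕ.* u) s (ℤₚ.≤-<-trans nonPos pos)
  where
  nonPos : -[1+ k ] ℤ.* + (n ℕ.* u) ℤ.≤ + 0
  nonPos = subst (ℤ._≤ + 0) (sym (ℤₚ.-◃n≡-n (ℕ.suc k ℕ.* (n ℕ.* u)))) ℤₚ.neg-≤-pos
  pos : + 0 ℤ.< + s ℤ.* + ℕ.suc d
  pos = +*+<+*+ 0 0 s (ℕ.suc d) (ℕₚ.*-mono-≤ (PellAffine⇒1≤s shape) (ℕ.s≤s ℕ.z≤n))
lower-bound p@(mkℚ (+ a) d _) (inj₁ p<0) _ _ _ = ⊥-elim (ℤ.Negative.neg (negative p<0))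
lower-bound p@(mkℚ (+ a) d _) (inj₂ 5p²<1) {n} {u} {s} shape b≤n n≤u =
  *ℕ/1<ℕ/1 p (n ℕ.* u) s (+*+<+*+ a (n ℕ.* u) s b (ratio-above a b shape (ℕ.s≤s ℕ.z≤n) 5a²+1≤b² b≤n n≤u))
  where
  b = ℕ.suc d
  5a²<b² : 5 ℕ.* a ℕ.* a ℕ.< b ℕ.* b
  5a²<b² = ℤₚ.drop‿+<+ (subst₂ ℤ._<_ (trans (cong (ℤ._* + a) (sym (ℤₚ.pos-* 5 a))) (sym (ℤₚ.pos-* (5 ℕ.* a) a)))
                                      (sym (ℤₚ.pos-* b b)) (5p²<1⇒ p 5p²<1))
  5a²+1≤b² : 5 ℕ.* (a ℕ.* a) ℕ.+ 1 ℕ.≤ b ℕ.* b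
  5a²+1≤b² = subst (ℕ._≤ b ℕ.* b) (trans (ℕₚ.+-comm 1 _) (cong (ℕ._+ 1) (ℕₚ.*-assoc 5 a a))) 5a²<b²

upper-bound : ∀ q → 0ℚ < q → 1ℚ < (+ 5 / 1) * q * q → ∀ {n u s} → PellAffine n u s →
              8 ℕ.* (ℤ.∣ ↥ q ∣ ℕ.* ↧ₙ q) ℕ.≤ n → 1 ℕ.≤ n → + s / 1 < q * (+ (n ℕ.* u) / 1)
upper-bound q@(mkℚ (+ 0)     _ _) 0<q _ _ _ _ = ⊥-elim (ℤ.Positive.pos (positive 0<q))
upper-bound q@(mkℚ -[1+ _ ]  _ _) 0<q _ _ _ _ = ⊥-elim (ℤ.Positive.pos (positive 0<q))
upper-bound q@(mkℚ (+ ℕ.suc k) d _) _ 1<5q² {n} {u} {s} shape 8ab≤n 1≤n =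
  ℕ/1<*ℕ/1 q (n ℕ.* u) s (+*+<+*+ s b a (n ℕ.* u) (ratio-below a b shape (ℕ.s≤s ℕ.z≤n) (ℕ.s≤s ℕ.z≤n) b²+1≤5a² 8ab≤n 1≤n))
  where
  a = ℕ.suc k
  b = ℕ.suc d
  b²+1≤5a² : b ℕ.* b ℕ.+ 1 ℕ.≤ 5 ℕ.* (a ℕ.* a)
  b²+1≤5a² = subst₂ ℕ._≤_ (ℕₚ.+-comm 1 (b ℕ.* b)) (ℕₚ.*-assoc 5 a a) (ℤₚ.drop‿+<+ (1<5q²⇒ q 1<5q²))

theorem11 : (p q : ℚ) →
    (p < 0ℚ ⊎ (+ 5 / 1) * p * p < 1ℚ) →
    (0ℚ < q × 1ℚ < (+ 5 / 1) * q * q) →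
    ∃[ N ] ((n : ℕ) → n ≥ N →
      (p * (+ (n Data.Nat.* D n) / 1) < (+ S n / 1))
      × ((+ S n / 1) < q * (+ (n Data.Nat.* D n) / 1)))
theorem11 p q p<1/√5 (0<q , 1/√5<q) = ℕ.suc (8 ℕ.* (ℤ.∣ ↥ q ∣ ℕ.* ↧ₙ q) ℕ.+ ↧ₙ p) , λ where
  (ℕ.suc r) (ℕ.s≤s N≤r) →
    lower-bound p p<1/√5 (pellAffine r) (ℕₚ.m≤n⇒m≤1+n (ℕₚ.≤-trans (ℕₚ.m≤n+m (↧ₙ p) _) N≤r)) (D-growth r) ,
    upper-bound q 0<q 1/√5<q (pellAffine r) (ℕₚ.m≤n⇒m≤1+n (ℕₚ.≤-trans (ℕₚ.m≤m+n _ (↧ₙ p)) N≤r)) (ℕ.s≤s ℕ.z≤n)
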